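{- Let $r \geq 1$ be an integer and let $G$ be an $r$-regular graph of order $n$ whose longest induced path has $k$ vertices. Then $$n \geq 2k + \left\lceil \frac{ -2(k-1)}{r} \right\rceil .$$
   Context: All graphs are finite and simple. $\mathrm{LIP}(G)$ denotes the number of vertices of a longest induced path in $G$; the hypothesis is $\mathrm{LIP}(G)=k$. -}

module Defs where

open import Data.Nat using (ℕ; zero; suc; _+_; _*_; _∸_; _≤_; NonZero)
open import Data.Nat.DivMod using (_/_)
open import Data.Integer as ℤ using (ℤ; +_; -[1+_]; -_)
open import Data.Fin using (Fin; toℕ)
open import Data.Bool using (Bool; true; false; T)
open import Data.Vec using (countᵇ; allFin)
open import Data.Product using (Σ; _×_; _,_)
open import Data.Sum using (_⊎_)
open import Function.Bundles using (_⇔_)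
open import Function.Definitions using (Injective)
open import Relation.Binary.PropositionalEquality using (_≡_)
open import Relation.Nullary using (¬_)

record Graph (n : ℕ) : Set where
  field
    adj   : Fin n → Fin n → Bool
    sym   : ∀ u v → adj u v ≡ adj v u
    irrefl : ∀ v → adj v v ≡ false
open Graph public

degree : ∀ {n} → Graph n → Fin n → ℕ
degree {n} G v = countᵇ (adj G v) (allFin n)

Regular : ∀ {n} → ℕ → Graph n → Set
Regular r G = ∀ v → degree G v ≡ r

Consecutive : ℕ → ℕ → Set
Consecutive i j = (suc i ≡ j) ⊎ (suc j ≡ i)

IsInducedPath : ∀ {n} → Graph n → (k : ℕ) → (Fin k → Fin n) → Set
IsInducedPath G k p =
  Injective _≡_ _≡_ p ×
  (∀ i j → T (adj G (p i) (p j)) ⇔ Consecutive (toℕ i) (toℕ j))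

LIP≡ : ∀ {n} → Graph n → ℕ → Set
LIP≡ G k =
  Σ (Fin k → Fin _) (IsInducedPath G k) ×
  (∀ m (p : Fin m → Fin _) → IsInducedPath G m p → m ≤ k)

ceilDiv : ℤ → (r : ℕ) → .{{NonZero r}} → ℤ
ceilDiv (+ m) r = + ((m + (r ∸ 1)) / r)
ceilDiv -[1+ m ] r = - (+ (suc m / r))

-- In an r-regular graph every vertex set S emits r·|S| edge-ends.  Those that do not
-- stay inside S land on the n − |S| vertices outside S, each of which absorbs at most
-- r of them, so 2r|S| ≤ rn + 2e(S), where 2e(S) counts ordered adjacent pairs in S.
-- For the vertex set of an induced path on k vertices 2e(S) = 2(k − 1), hence
-- 2rk ≤ rn + 2(k − 1), i.e. n ≥ 2k − ⌊2(k − 1)/r⌋ = 2k + ⌈−2(k − 1)/r⌉.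
module Submission where

open import Defs hiding (sym)
open import Data.Nat using (ℕ; suc; _*_; _∸_; NonZero)

-- A submodule, so that ℕ's _+_ used here does not clash with the ℤ _+_ of the statement.
module InducedPathCounting where

  open import Data.Nat using (zero; _+_; _≤_; _⊓_; _≡ᵇ_; _<ᵇ_; z≤n)
  open import Data.Nat.Properties
    using (+-*-semiring; module ≤-Reasoning; ≤-refl; ≤-reflexive; ≤-trans; n≤1+n; n<1+n;
           m≤m+n; m≤n+m; +-identityʳ; *-identityˡ; *-identityʳ; *-comm; *-distribˡ-+;
           +-mono-≤; +-monoˡ-≤; +-monoʳ-≤; *-monoʳ-≤; m∸n+n≡m; m+n∸n≡m; m≥n⇒m⊓n≡n; ≡⇒≡ᵇ)
  open import Data.Nat.DivMod using (_/_; m*n/n≡m; /-monoˡ-≤; +-distrib-/-∣ˡ; m<n⇒m/n≡0)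
  open import Data.Nat.Divisibility using (n∣m*n)
  open import Data.Nat.Tactic.RingSolver using (solve-∀)
  open import Data.Integer as ℤ using (_⊖_)
  import Data.Integer.Properties as ℤ
  open import Data.Fin using (Fin; zero; suc; toℕ)
  open import Data.Fin.Properties using (_≟_; suc-injective; 0≢1+n)
  open import Data.Bool using (Bool; true; false; T)
  open import Data.Unit using (tt)
  open import Data.Vec using (countᵇ; tabulate)
  open import Data.Product using (_,_; proj₁)
  open import Data.Sum using (inj₁; inj₂)
  open import Function using (_∘_; id)
  open import Function.Bundles using (Equivalence)
  open import Function.Definitions using (Injective)
  open import Relation.Binary.PropositionalEquality
  open import Relation.Nullary using (does; yes; no)
  open import Relation.Nullary.Decidable using (dec-false)
  open import Algebra.Properties.Semiring.Sum +-*-semiring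
    using (sum; sum-syntax; sum-cong-≗; sum-replicate-zero; ∑-distrib-+; ∑-comm;
           *-distribˡ-sum; *-distribʳ-sum)

  𝟙 : Bool → ℕ
  𝟙 true  = 1
  𝟙 false = 0

  T⇒1≤𝟙 : ∀ {b} → T b → 1 ≤ 𝟙 b
  T⇒1≤𝟙 {true} _ = ≤-refl

  ∑-mono-≤ : ∀ {n} {f g : Fin n → ℕ} → (∀ i → f i ≤ g i) → sum f ≤ sum g
  ∑-mono-≤ {zero}  f≤g = z≤n
  ∑-mono-≤ {suc n} f≤g = +-mono-≤ (f≤g zero) (∑-mono-≤ (f≤g ∘ suc))

  ∑-const : ∀ n c → ∑[ i < n ] c ≡ n * c
  ∑-const zero    c = refl
  ∑-const (suc n) c = cong (c +_) (∑-const n c)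

  countᵇ-tabulate : ∀ {A : Set} {n} (q : A → Bool) (g : Fin n → A) →
                    countᵇ q (tabulate g) ≡ ∑[ i < n ] 𝟙 (q (g i))
  countᵇ-tabulate {n = zero}  q g = refl
  countᵇ-tabulate {n = suc n} q g with q (g zero)
  ... | true  = cong suc (countᵇ-tabulate q (g ∘ suc))
  ... | false = countᵇ-tabulate q (g ∘ suc)

  δ : ∀ {n} → Fin n → Fin n → ℕ
  δ a v = 𝟙 (does (a ≟ v))

  ∑-δ : ∀ {n} (a : Fin n) (f : Fin n → ℕ) → ∑[ v < n ] (δ a v * f v) ≡ f a
  ∑-δ {suc n} zero f = begin
    1 * f zero + ∑[ v < n ] 0  ≡⟨ cong₂ _+_ (*-identityˡ (f zero)) (sum-replicate-zero n) ⟩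
    f zero + 0                 ≡⟨ +-identityʳ (f zero) ⟩
    f zero                     ∎
    where open ≡-Reasoning
  ∑-δ {suc n} (suc a) f = ∑-δ a (f ∘ suc)

  hits : ∀ {k n} → (Fin k → Fin n) → Fin n → ℕ
  hits {k} p v = ∑[ i < k ] δ (p i) v

  ∑-hits-* : ∀ {k n} (p : Fin k → Fin n) (f : Fin n → ℕ) →
             ∑[ v < n ] (hits p v * f v) ≡ ∑[ i < k ] f (p i)
  ∑-hits-* {k} {n} p f = begin
    ∑[ v < n ] (hits p v * f v)
      ≡⟨ sum-cong-≗ (λ v → *-distribʳ-sum (f v) (λ i → δ (p i) v)) ⟩
    ∑[ v < n ] ∑[ i < k ] (δ (p i) v * f v) ≡⟨ ∑-comm (λ v i → δ (p i) v * f v) ⟩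
    ∑[ i < k ] ∑[ v < n ] (δ (p i) v * f v) ≡⟨ sum-cong-≗ (λ i → ∑-δ (p i) f) ⟩
    ∑[ i < k ] f (p i)                      ∎
    where open ≡-Reasoning

  ∑-hits : ∀ {k n} (p : Fin k → Fin n) → ∑[ v < n ] hits p v ≡ k
  ∑-hits {k} p = begin
    ∑[ v < _ ] hits p v       ≡⟨ sum-cong-≗ (λ v → sym (*-identityʳ (hits p v))) ⟩
    ∑[ v < _ ] (hits p v * 1) ≡⟨ ∑-hits-* p (λ _ → 1) ⟩
    ∑[ i < k ] 1              ≡⟨ ∑-const k 1 ⟩
    k * 1                     ≡⟨ *-identityʳ k ⟩
    k                         ∎
    where open ≡-Reasoning

  hits≡0 : ∀ {k n} {p : Fin k → Fin n} {v} → (∀ i → p i ≢ v) → hits p v ≡ 0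
  hits≡0 {k} {p = p} {v} p≢v =
    trans (sum-cong-≗ (λ i → cong 𝟙 (dec-false (p i ≟ v) (p≢v i)))) (sum-replicate-zero k)

  hits≤1 : ∀ {k n} {p : Fin k → Fin n} → Injective _≡_ _≡_ p → ∀ v → hits p v ≤ 1
  hits≤1 {zero}          inj v = z≤n
  hits≤1 {suc k} {p = p} inj v with p zero ≟ v
  ... | yes refl =
    ≤-reflexive (cong suc (hits≡0 {p = p ∘ suc} (λ i pᵢ≡p₀ → 0≢1+n (sym (inj pᵢ≡p₀)))))
  ... | no  _    = hits≤1 (suc-injective ∘ inj) v

  -- Vertex sets are encoded as 0/1 weights on Fin n; the image of an injective p is hits p.

  module _ {n} (G : Graph n) where

    A : Fin n → Fin n → ℕ
    A v u = 𝟙 (adj G v u)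

    degreeInto : (Fin n → ℕ) → Fin n → ℕ
    degreeInto y v = ∑[ u < n ] (A v u * y u)

    edgesBetween : (Fin n → ℕ) → (Fin n → ℕ) → ℕ
    edgesBetween x y = ∑[ v < n ] (x v * degreeInto y v)

    ∑-A≡r : ∀ {r} → Regular r G → ∀ v → ∑[ u < n ] A v u ≡ r
    ∑-A≡r reg v = trans (sym (countᵇ-tabulate (adj G v) id)) (reg v)

    degreeInto-≤ : ∀ {r y} → Regular r G → (∀ u → y u ≤ 1) → ∀ v → degreeInto y v ≤ r
    degreeInto-≤ {r} {y} reg y≤1 v = begin
      ∑[ u < n ] (A v u * y u) ≤⟨ ∑-mono-≤ (λ u → *-monoʳ-≤ (A v u) (y≤1 u)) ⟩
      ∑[ u < n ] (A v u * 1)   ≡⟨ sum-cong-≗ (λ u → *-identityʳ (A v u)) ⟩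
      ∑[ u < n ] A v u         ≡⟨ ∑-A≡r reg v ⟩
      r                        ∎
      where open ≤-Reasoning

    degreeInto-split : ∀ {r y z} → Regular r G → (∀ u → y u + z u ≡ 1) →
                       ∀ v → degreeInto y v + degreeInto z v ≡ r
    degreeInto-split {r} {y} {z} reg y+z≡1 v = begin
      degreeInto y v + degreeInto z v
        ≡⟨ ∑-distrib-+ (λ u → A v u * y u) (λ u → A v u * z u) ⟨
      ∑[ u < n ] (A v u * y u + A v u * z u)
        ≡⟨ sum-cong-≗ (λ u → *-distribˡ-+ (A v u) (y u) (z u)) ⟨
      ∑[ u < n ] (A v u * (y u + z u))       ≡⟨ sum-cong-≗ (λ u → cong (A v u *_) (y+z≡1 u)) ⟩
      ∑[ u < n ] (A v u * 1)                 ≡⟨ sum-cong-≗ (λ u → *-identityʳ (A v u)) ⟩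
      ∑[ u < n ] A v u                       ≡⟨ ∑-A≡r reg v ⟩
      r                                      ∎
      where open ≡-Reasoning

    edgesBetween-comm : ∀ x y → edgesBetween x y ≡ edgesBetween y x
    edgesBetween-comm x y = begin
      ∑[ v < n ] (x v * degreeInto y v)
        ≡⟨ sum-cong-≗ (λ v → *-distribˡ-sum (x v) (λ u → A v u * y u)) ⟩
      ∑[ v < n ] ∑[ u < n ] (x v * (A v u * y u))   ≡⟨ ∑-comm (λ v u → x v * (A v u * y u)) ⟩
      ∑[ u < n ] ∑[ v < n ] (x v * (A v u * y u))
        ≡⟨ sum-cong-≗ (λ u → sum-cong-≗ (λ v → swap v u)) ⟩
      ∑[ u < n ] ∑[ v < n ] (y u * (A u v * x v))
        ≡⟨ sum-cong-≗ (λ u → *-distribˡ-sum (y u) (λ v → A u v * x v)) ⟨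
      ∑[ u < n ] (y u * degreeInto x u)             ∎
      where
      open ≡-Reasoning
      rotate : ∀ a b c → a * (b * c) ≡ c * (b * a)
      rotate = solve-∀
      swap : ∀ v u → x v * (A v u * y u) ≡ y u * (A u v * x v)
      swap v u rewrite Graph.sym G v u = rotate (x v) (A u v) (y u)

    edgesBetween-≤ : ∀ {r} → Regular r G → ∀ x {y} → (∀ u → y u ≤ 1) →
                     edgesBetween x y ≤ sum x * r
    edgesBetween-≤ {r} reg x {y} y≤1 = begin
      ∑[ v < n ] (x v * degreeInto y v)
        ≤⟨ ∑-mono-≤ (λ v → *-monoʳ-≤ (x v) (degreeInto-≤ reg y≤1 v)) ⟩
      ∑[ v < n ] (x v * r)              ≡⟨ *-distribʳ-sum r x ⟨
      sum x * r                         ∎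
      where open ≤-Reasoning

    edgesBetween-split : ∀ {r} → Regular r G → ∀ x {y z} → (∀ u → y u + z u ≡ 1) →
                         edgesBetween x y + edgesBetween x z ≡ sum x * r
    edgesBetween-split {r} reg x {y} {z} y+z≡1 = begin
      edgesBetween x y + edgesBetween x z
        ≡⟨ ∑-distrib-+ (λ v → x v * degreeInto y v) _ ⟨
      ∑[ v < n ] (x v * degreeInto y v + x v * degreeInto z v)
        ≡⟨ sum-cong-≗ (λ v → *-distribˡ-+ (x v) _ _) ⟨
      ∑[ v < n ] (x v * (degreeInto y v + degreeInto z v))
        ≡⟨ sum-cong-≗ (λ v → cong (x v *_) (degreeInto-split reg y+z≡1 v)) ⟩
      ∑[ v < n ] (x v * r)                                         ≡⟨ *-distribʳ-sum r x ⟨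
      sum x * r                                                    ∎
      where open ≡-Reasoning

    regular-cut-bound : ∀ {r} → Regular r G → ∀ w → (∀ v → w v ≤ 1) →
                        2 * sum w * r ≤ n * r + edgesBetween w w
    regular-cut-bound {r} reg w w≤1 = begin
      2 * sum w * r                                ≡⟨ double (sum w) r ⟩
      sum w * r + sum w * r
        ≡⟨ cong (sum w * r +_) (edgesBetween-split reg w o+w≡1) ⟨
      sum w * r + (edgesBetween w o + edgesBetween w w)
        ≡⟨ cong (λ t → sum w * r + (t + edgesBetween w w)) (edgesBetween-comm w o) ⟩
      sum w * r + (edgesBetween o w + edgesBetween w w)
        ≤⟨ +-monoʳ-≤ (sum w * r) (+-monoˡ-≤ (edgesBetween w w) (edgesBetween-≤ reg o w≤1)) ⟩
      sum w * r + (sum o * r + edgesBetween w w)   ≡⟨ regroup (sum w) (sum o) r _ ⟩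
      (sum o + sum w) * r + edgesBetween w w
        ≡⟨ cong (λ t → t * r + edgesBetween w w) ∑o+∑w≡n ⟩
      n * r + edgesBetween w w                     ∎
      where
      open ≤-Reasoning
      o : Fin n → ℕ
      o v = 1 ∸ w v
      o+w≡1 : ∀ v → o v + w v ≡ 1
      o+w≡1 v = m∸n+n≡m (w≤1 v)
      ∑o+∑w≡n : sum o + sum w ≡ n
      ∑o+∑w≡n = trans (sym (∑-distrib-+ o w))
                      (trans (sum-cong-≗ o+w≡1) (trans (∑-const n 1) (*-identityʳ n)))
      double : ∀ s r → 2 * s * r ≡ s * r + s * r
      double = solve-∀
      regroup : ∀ s t r e → s * r + (t * r + e) ≡ (t + s) * r + e
      regroup = solve-∀

    degreeInto-hits : ∀ {k} (p : Fin k → Fin n) v → degreeInto (hits p) v ≡ ∑[ j < k ] A v (p j)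
    degreeInto-hits p v =
      trans (sum-cong-≗ (λ u → *-comm (A v u) (hits p u))) (∑-hits-* p (A v))

    edgesBetween-hits : ∀ {k} (p : Fin k → Fin n) →
      edgesBetween (hits p) (hits p) ≡ ∑[ i < k ] ∑[ j < k ] A (p i) (p j)
    edgesBetween-hits p =
      trans (∑-hits-* p (degreeInto (hits p))) (sum-cong-≗ (λ i → degreeInto-hits p (p i)))

  ∑-≡ᵇ-toℕ : ∀ k c → ∑[ j < k ] 𝟙 (c ≡ᵇ toℕ j) ≡ 𝟙 (c <ᵇ k)
  ∑-≡ᵇ-toℕ zero    c       = refl
  ∑-≡ᵇ-toℕ (suc k) zero    = cong suc (sum-replicate-zero k)
  ∑-≡ᵇ-toℕ (suc k) (suc c) = ∑-≡ᵇ-toℕ k c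

  ∑-<ᵇ-toℕ : ∀ k m → ∑[ i < k ] 𝟙 (toℕ i <ᵇ m) ≡ k ⊓ m
  ∑-<ᵇ-toℕ zero    m       = refl
  ∑-<ᵇ-toℕ (suc k) zero    = sum-replicate-zero (suc k)
  ∑-<ᵇ-toℕ (suc k) (suc m) = cong suc (∑-<ᵇ-toℕ k m)

  ∑-successor-pairs : ∀ k → ∑[ i < k ] ∑[ j < k ] 𝟙 (suc (toℕ i) ≡ᵇ toℕ j) ≡ k ∸ 1
  ∑-successor-pairs zero    = refl
  ∑-successor-pairs (suc k) = begin
    ∑[ i < suc k ] ∑[ j < suc k ] 𝟙 (suc (toℕ i) ≡ᵇ toℕ j)
      ≡⟨ sum-cong-≗ {suc k} (λ i → ∑-≡ᵇ-toℕ (suc k) (suc (toℕ i))) ⟩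
    ∑[ i < suc k ] 𝟙 (toℕ i <ᵇ k)                        ≡⟨ ∑-<ᵇ-toℕ (suc k) k ⟩
    suc k ⊓ k                                           ≡⟨ m≥n⇒m⊓n≡n (n≤1+n k) ⟩
    k                                                   ∎
    where open ≡-Reasoning

  induced-path-edges≤ : ∀ {n k} (G : Graph n) {p : Fin k → Fin n} → IsInducedPath G k p →
    ∑[ i < k ] ∑[ j < k ] A G (p i) (p j) ≤ 2 * (k ∸ 1)
  induced-path-edges≤ {k = k} G {p} (_ , adj⇔consecutive) = begin
    ∑[ i < k ] ∑[ j < k ] A G (p i) (p j)      ≤⟨ ∑-mono-≤ (λ i → ∑-mono-≤ (λ j → A≤ i j)) ⟩
    ∑[ i < k ] ∑[ j < k ] (s i j + s j i)
      ≡⟨ sum-cong-≗ (λ i → ∑-distrib-+ (s i) (λ j → s j i)) ⟩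
    ∑[ i < k ] (∑[ j < k ] s i j + ∑[ j < k ] s j i) ≡⟨ ∑-distrib-+ (λ i → ∑[ j < k ] s i j) _ ⟩
    S + ∑[ i < k ] ∑[ j < k ] s j i           ≡⟨ cong (S +_) (∑-comm s) ⟨
    S + S                                     ≡⟨ cong (λ t → t + t) (∑-successor-pairs k) ⟩
    (k ∸ 1) + (k ∸ 1)                         ≡⟨ cong ((k ∸ 1) +_) (+-identityʳ (k ∸ 1)) ⟨
    2 * (k ∸ 1)                               ∎
    where
    open ≤-Reasoning
    s : Fin k → Fin k → ℕ
    s i j = 𝟙 (suc (toℕ i) ≡ᵇ toℕ j)
    S : ℕ
    S = ∑[ i < k ] ∑[ j < k ] s i j
    A≤ : ∀ i j → A G (p i) (p j) ≤ s i j + s j i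
    A≤ i j with adj G (p i) (p j) in adjacent
    ... | false = z≤n
    ... | true with Equivalence.to (adj⇔consecutive i j) (subst T (sym adjacent) tt)
    ... | inj₁ i+1≡j = ≤-trans (T⇒1≤𝟙 (≡⇒≡ᵇ _ _ i+1≡j)) (m≤m+n (s i j) (s j i))
    ... | inj₂ j+1≡i = ≤-trans (T⇒1≤𝟙 (≡⇒≡ᵇ _ _ j+1≡i)) (m≤n+m (s j i) (s i j))

  induced-path-bound : ∀ {n k r} (G : Graph n) {p : Fin k → Fin n} → Regular r G →
    IsInducedPath G k p → 2 * k * r ≤ n * r + 2 * (k ∸ 1)
  induced-path-bound {n} {k} {r} G {p} reg path = begin
    2 * k * r                                  ≡⟨ cong (λ t → 2 * t * r) (∑-hits p) ⟨
    2 * sum (hits p) * r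
      ≤⟨ regular-cut-bound G reg (hits p) (hits≤1 (proj₁ path)) ⟩
    n * r + edgesBetween G (hits p) (hits p)   ≡⟨ cong (n * r +_) (edgesBetween-hits G p) ⟩
    n * r + ∑[ i < k ] ∑[ j < k ] A G (p i) (p j)
      ≤⟨ +-monoʳ-≤ (n * r) (induced-path-edges≤ G path) ⟩
    n * r + 2 * (k ∸ 1)                        ∎
    where open ≤-Reasoning

  m*n≤o*n+p⇒m≤o+p/n : ∀ {m n o p} .{{_ : NonZero n}} → m * n ≤ o * n + p → m ≤ o + p / n
  m*n≤o*n+p⇒m≤o+p/n {m} {n} {o} {p} m*n≤o*n+p = begin
    m                   ≡⟨ m*n/n≡m m n ⟨
    m * n / n           ≤⟨ /-monoˡ-≤ n m*n≤o*n+p ⟩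
    (o * n + p) / n     ≡⟨ +-distrib-/-∣ˡ p (n∣m*n o) ⟩
    o * n / n + p / n   ≡⟨ cong (_+ p / n) (m*n/n≡m o n) ⟩
    o + p / n           ∎
    where open ≤-Reasoning

  ceilDiv-neg : ∀ m r .{{_ : NonZero r}} → ceilDiv (ℤ.- (ℤ.+ m)) r ≡ ℤ.- (ℤ.+ (m / r))
  ceilDiv-neg zero    (suc r) = cong ℤ.+_ (m<n⇒m/n≡0 (n<1+n r))
  ceilDiv-neg (suc m) r       = refl

  m≤n+o⇒m-o≤n : ∀ {m n o} → m ≤ n + o → ℤ._≤_ (ℤ.+ m ℤ.- ℤ.+ o) (ℤ.+ n)
  m≤n+o⇒m-o≤n {m} {n} {o} m≤n+o = begin
    ℤ.+ m ℤ.- ℤ.+ o   ≡⟨ ℤ.m-n≡m⊖n m o ⟩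
    m ⊖ o             ≤⟨ ℤ.⊖-monoˡ-≤ o m≤n+o ⟩
    (n + o) ⊖ o       ≡⟨ ℤ.⊖-≥ (m≤n+m o n) ⟩
    ℤ.+ (n + o ∸ o)   ≡⟨ cong ℤ.+_ (m+n∸n≡m n o) ⟩
    ℤ.+ n             ∎
    where open ℤ.≤-Reasoning

open InducedPathCounting using (induced-path-bound; m*n≤o*n+p⇒m≤o+p/n; ceilDiv-neg; m≤n+o⇒m-o≤n)
open import Data.Nat.DivMod using (_/_)
open import Data.Integer as ℤ using (+_; _+_; -_; _-_)
open import Data.Integer.Properties using (module ≤-Reasoning)
open import Data.Product using (_,_)
open import Relation.Binary.PropositionalEquality using (cong)

theorem2 : (r : ℕ) → .{{_ : NonZero r}} → (n k : ℕ) → .{{_ : NonZero n}} → (G : Graph n) →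
    Regular r G → LIP≡ G k →
    ℤ._≤_ (+ (2 * k) + ceilDiv (- (+ (2 * (k ∸ 1)))) r) (+ n)
theorem2 r n k G reg ((p , path) , _) = begin
  + (2 * k) + ceilDiv (- (+ (2 * (k ∸ 1)))) r
    ≡⟨ cong (λ c → + (2 * k) + c) (ceilDiv-neg (2 * (k ∸ 1)) r) ⟩
  + (2 * k) - + (2 * (k ∸ 1) / r)
    ≤⟨ m≤n+o⇒m-o≤n (m*n≤o*n+p⇒m≤o+p/n {n = r} (induced-path-bound G reg path)) ⟩
  + n ∎
  where open ≤-Reasoning
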